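{- Let $A$ carry an IF-structure in a strict symmetric monoidal $\dagger$-category $\mathcal{C}$, together with groups $G_K$ of green phases and $H_K$ of red phases satisfying the IFK equations, and suppose $A$ has enough green-set-like elements with respect to $H_K$. Suppose $H_K$ is finite with exponent $d$. Then the internal integers form the finite ring $\mathbb{Z}_d$; that is, $\mathbf{n}=\mathbf{m}$ whenever $n\equiv m \pmod d$.
   Context: Work in a strict symmetric monoidal $\dagger$-category (unit $I$, symmetry $\sigma$, $\dagger$ involutive identity-on-objects contravariant, compatible with $\otimes$). A $\dagger$-SCFA on $A$ is $(\mu,\eta,\delta=\mu^\dagger,\epsilon=\eta^\dagger)$ with $(\mu,\eta)$ a commutative monoid, $(\mu\otimes\mathrm{id})(\mathrm{id}\otimes\delta)=\delta\mu=(\mathrm{id}\otimes\mu)(\delta\otimes\mathrm{id})$, and $\mu\delta=\mathrm{id}_A$. An IF-structure on $A$ is a pair of $\dagger$-SCFAs, green $(\mu_g,\eta_g,\delta_g,\epsilon_g)$ and red $(\mu_r,\eta_r,\delta_r,\epsilon_r)$, such that $\delta_g\mu_r=(\mu_r\otimes\mu_r)(\mathrm{id}\otimes\sigma\otimes\mathrm{id})(\delta_g\otimes\delta_g)$, $\delta_g\eta_r=\eta_r\otimes\eta_r$, $\epsilon_g\mu_r=\epsilon_g\otimes\epsilon_g$, and $\eta_r=(\epsilon_r\otimes\mathrm{id}_A)\delta_g\eta_g$, $\epsilon_g=\epsilon_r\mu_r(\mathrm{id}_A\otimes\eta_g)$; scalar factors built from $\epsilon_g\eta_r$ accompanying the bialgebra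 laws are suppressed throughout (and $\epsilon_g\eta_r=\mathrm{id}_I$ is not imposed). For a colour $c$, a $c$-phase is a unitary $\alpha:A\to A$ with $\mu_c\circ(\alpha\otimes\mathrm{id}_A)=\alpha\circ\mu_c$; a point $\psi:I\to A$ is $c$-set-like if $\delta_c\circ\psi=\psi\otimes\psi$. IFK equations: $G_K$ is a group (under composition) of green phases such that $g\circ\eta_g$ is red-set-like for each $g\in G_K$, and $H_K$ is a group of red phases such that $h\circ\eta_r$ is green-set-like for each $h\in H_K$. Enough green-set-like elements: for all objects $B$ and $f,f':A\to B$, if $f\circ h\circ\eta_r=f'\circ h\circ\eta_r$ for all $h\in H_K$ then $f=f'$. Internal integers: $\mathbf{0}:=\eta_r\circ\epsilon_g$ and $\mathbf{n+1}:=\mu_r\circ(\mathbf{n}\otimes\mathrm{id}_A)\circ\delta_g$ for $n\in\mathbb{N}$; these form a ring under the convolution sum $f+f':=\mu_r\circ(f\otimes f')\circ\delta_g$ and composition. The exponent of a finite group is the least positive $d$ with $x^d=e$ for all $x$. -}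

module Defs where

open import Level using (Level; _⊔_; suc)
open import Data.Nat using (ℕ; zero; suc; _≤_; _<_)
open import Data.Fin using (Fin)
open import Data.Product using (Σ; ∃; _×_; _,_)
open import Relation.Binary.PropositionalEquality using (_≡_; refl; sym; trans; subst)
open import Relation.Binary.Structures using (IsEquivalence)

record Category (o ℓ e : Level) : Set (Level.suc (o ⊔ ℓ ⊔ e)) where
  infix  4 _≈_
  infixr 9 _∘_
  field
    Obj   : Set o
    Hom   : Obj → Obj → Set ℓ
    _≈_   : ∀ {X Y} → Hom X Y → Hom X Y → Set e
    ≈-equiv : ∀ {X Y} → IsEquivalence (_≈_ {X} {Y})
    id    : ∀ {X} → Hom X X
    _∘_   : ∀ {X Y Z} → Hom Y Z → Hom X Y → Hom X Z
    assoc : ∀ {W X Y Z} {f : Hom W X} {g : Hom X Y} {h : Hom Y Z} →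
            (h ∘ g) ∘ f ≈ h ∘ (g ∘ f)
    identityˡ : ∀ {X Y} {f : Hom X Y} → id ∘ f ≈ f
    identityʳ : ∀ {X Y} {f : Hom X Y} → f ∘ id ≈ f
    ∘-resp-≈  : ∀ {X Y Z} {f f' : Hom Y Z} {g g' : Hom X Y} →
                f ≈ f' → g ≈ g' → f ∘ g ≈ f' ∘ g'

-- identity morphism transported along an equality of objects
-- (the "identity" coherence morphisms of a strict monoidal category)
cast : ∀ {o ℓ e} (C : Category o ℓ e) {X Y : Category.Obj C} → X ≡ Y → Category.Hom C X Y
cast C {X} p = subst (Category.Hom C X) p (Category.id C)

record StrictSymMonDaggerCat (o ℓ e : Level) : Set (Level.suc (o ⊔ ℓ ⊔ e)) where
  infixr 10 _⊗₀_ _⊗₁_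
  field
    cat : Category o ℓ e
  open Category cat public
  field
    _⊗₀_ : Obj → Obj → Obj
    I    : Obj
    _⊗₁_ : ∀ {X Y X' Y'} → Hom X Y → Hom X' Y' → Hom (X ⊗₀ X') (Y ⊗₀ Y')
    ⊗-id   : ∀ {X Y} → id {X} ⊗₁ id {Y} ≈ id
    ⊗-∘    : ∀ {X Y Z X' Y' Z'} {f : Hom Y Z} {g : Hom X Y} {f' : Hom Y' Z'} {g' : Hom X' Y'} →
             (f ∘ g) ⊗₁ (f' ∘ g') ≈ (f ⊗₁ f') ∘ (g ⊗₁ g')
    ⊗-resp-≈ : ∀ {X Y X' Y'} {f g : Hom X Y} {f' g' : Hom X' Y'} →
               f ≈ g → f' ≈ g' → f ⊗₁ f' ≈ g ⊗₁ g'
    assocObj  : ∀ {X Y Z} → (X ⊗₀ Y) ⊗₀ Z ≡ X ⊗₀ (Y ⊗₀ Z)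
    unitˡObj  : ∀ {X} → I ⊗₀ X ≡ X
    unitʳObj  : ∀ {X} → X ⊗₀ I ≡ X
    assoc-⊗₁  : ∀ {X Y Z X' Y' Z'} {f : Hom X X'} {g : Hom Y Y'} {h : Hom Z Z'} →
                cast cat assocObj ∘ ((f ⊗₁ g) ⊗₁ h) ≈ (f ⊗₁ (g ⊗₁ h)) ∘ cast cat assocObj
    unitˡ-⊗₁  : ∀ {X Y} {f : Hom X Y} → cast cat unitˡObj ∘ (id {I} ⊗₁ f) ≈ f ∘ cast cat unitˡObj
    unitʳ-⊗₁  : ∀ {X Y} {f : Hom X Y} → cast cat unitʳObj ∘ (f ⊗₁ id {I}) ≈ f ∘ cast cat unitʳObj
    σ : ∀ {X Y} → Hom (X ⊗₀ Y) (Y ⊗₀ X)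
    σ-natural : ∀ {X Y X' Y'} {f : Hom X X'} {g : Hom Y Y'} →
                σ ∘ (f ⊗₁ g) ≈ (g ⊗₁ f) ∘ σ
    σ-involutive : ∀ {X Y} → σ {Y} {X} ∘ σ {X} {Y} ≈ id
    σ-hexagon : ∀ {X Y Z} →
                σ {X} {Y ⊗₀ Z} ≈
                  cast cat (sym assocObj) ∘ (id {Y} ⊗₁ σ {X} {Z}) ∘ cast cat assocObj
                  ∘ (σ {X} {Y} ⊗₁ id {Z}) ∘ cast cat (sym assocObj)
    σ-unit : ∀ {X} → σ {X} {I} ≈ cast cat (trans unitʳObj (sym unitˡObj))
    _† : ∀ {X Y} → Hom X Y → Hom Y X
    †-involutive : ∀ {X Y} {f : Hom X Y} → (f †) † ≈ f
    †-id  : ∀ {X} → (id {X}) † ≈ id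
    †-∘   : ∀ {X Y Z} {f : Hom Y Z} {g : Hom X Y} → (f ∘ g) † ≈ (g †) ∘ (f †)
    †-resp-≈ : ∀ {X Y} {f g : Hom X Y} → f ≈ g → f † ≈ g †
    †-⊗   : ∀ {X Y X' Y'} {f : Hom X Y} {g : Hom X' Y'} → (f ⊗₁ g) † ≈ (f †) ⊗₁ (g †)
    †-σ   : ∀ {X Y} → (σ {X} {Y}) † ≈ σ {Y} {X}

module _ {o ℓ e} (C : StrictSymMonDaggerCat o ℓ e) where
  open StrictSymMonDaggerCat C

  private
    α : ∀ {X Y Z} → Hom ((X ⊗₀ Y) ⊗₀ Z) (X ⊗₀ (Y ⊗₀ Z))
    α = cast cat assocObj
    α⁻ : ∀ {X Y Z} → Hom (X ⊗₀ (Y ⊗₀ Z)) ((X ⊗₀ Y) ⊗₀ Z)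
    α⁻ = cast cat (sym assocObj)
    λ⁻ : ∀ {X} → Hom X (I ⊗₀ X)
    λ⁻ = cast cat (sym unitˡObj)
    λ' : ∀ {X} → Hom (I ⊗₀ X) X
    λ' = cast cat unitˡObj
    ρ⁻ : ∀ {X} → Hom X (X ⊗₀ I)
    ρ⁻ = cast cat (sym unitʳObj)

  record DaggerSCFA (A : Obj) : Set (ℓ ⊔ e) where
    field
      μ : Hom (A ⊗₀ A) A
      η : Hom I A
    δ : Hom A (A ⊗₀ A)
    δ = μ †
    ε : Hom A I
    ε = η †
    field
      μ-assoc : μ ∘ (μ ⊗₁ id) ≈ μ ∘ (id ⊗₁ μ) ∘ α
      μ-unitˡ : μ ∘ (η ⊗₁ id) ≈ λ'
      μ-comm  : μ ∘ σ ≈ μ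
      frobeniusˡ : (μ ⊗₁ id) ∘ α⁻ ∘ (id ⊗₁ δ) ≈ δ ∘ μ
      frobeniusʳ : (id ⊗₁ μ) ∘ α ∘ (δ ⊗₁ id) ≈ δ ∘ μ
      special : μ ∘ δ ≈ id

  -- IF-structure: green and red †-SCFAs with the stated interaction laws
  -- (scalar factors are suppressed, i.e. the laws are imposed as written)
  record IFStructure (A : Obj) : Set (ℓ ⊔ e) where
    field
      green red : DaggerSCFA A
    open DaggerSCFA green public renaming (μ to μg; η to ηg; δ to δg; ε to εg)
    open DaggerSCFA red   public renaming (μ to μr; η to ηr; δ to δr; ε to εr)
    field
      bialg : δg ∘ μr ≈
              (μr ⊗₁ μr) ∘ α⁻ ∘ (id ⊗₁ (α ∘ ((σ ⊗₁ id) ∘ α⁻))) ∘ α ∘ (δg ⊗₁ δg)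
      copy-ηr : δg ∘ ηr ≈ (ηr ⊗₁ ηr) ∘ λ⁻
      cocopy-εg : εg ∘ μr ≈ λ' ∘ (εg ⊗₁ εg)
      ηr-def : ηr ≈ λ' ∘ (εr ⊗₁ id) ∘ δg ∘ ηg
      εg-def : εg ≈ εr ∘ μr ∘ (id ⊗₁ ηg) ∘ ρ⁻

  module _ {A : Obj} where
    Unitary : Hom A A → Set e
    Unitary f = ((f †) ∘ f ≈ id) × (f ∘ (f †) ≈ id)

    IsPhase : DaggerSCFA A → Hom A A → Set e
    IsPhase F f = Unitary f × (DaggerSCFA.μ F ∘ (f ⊗₁ id) ≈ f ∘ DaggerSCFA.μ F)

    SetLike : DaggerSCFA A → Hom I A → Set e
    SetLike F ψ = DaggerSCFA.δ F ∘ ψ ≈ (ψ ⊗₁ ψ) ∘ λ⁻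

    pow : Hom A A → ℕ → Hom A A
    pow f zero    = id
    pow f (suc k) = f ∘ pow f k

  record IFK {A : Obj} (F : IFStructure A) (ℓG : Level) : Set (ℓ ⊔ e ⊔ Level.suc ℓG) where
    open IFStructure F
    field
      G       : Hom A A → Set ℓG
      G-resp  : ∀ {f f'} → f ≈ f' → G f → G f'
      G-id    : G id
      G-∘     : ∀ {f f'} → G f → G f' → G (f ∘ f')
      G-inv   : ∀ {f} → G f → Σ (Hom A A) λ f' → G f' × (f' ∘ f ≈ id) × (f ∘ f' ≈ id)
      G-phase : ∀ {f} → G f → IsPhase green f
      G-eq    : ∀ {f} → G f → SetLike red (f ∘ ηg)
      nH      : ℕ
      h       : Fin nH → Hom A A
      H-id    : ∃ λ i → h i ≈ id
      H-∘     : ∀ i j → ∃ λ k → h k ≈ h i ∘ h j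
      H-inv   : ∀ i → ∃ λ j → (h j ∘ h i ≈ id) × (h i ∘ h j ≈ id)
      H-phase : ∀ i → IsPhase red (h i)
      H-eq    : ∀ i → SetLike green (h i ∘ ηr)

  module _ {A : Obj} {F : IFStructure A} {ℓG : Level} (K : IFK F ℓG) where
    open IFStructure F
    open IFK K

    EnoughGreenSetLike : Set (o ⊔ ℓ ⊔ e)
    EnoughGreenSetLike = ∀ {B : Obj} (f f' : Hom A B) →
      (∀ i → f ∘ h i ∘ ηr ≈ f' ∘ h i ∘ ηr) → f ≈ f'

    IsExponent : ℕ → Set e
    IsExponent d = (0 < d) × (∀ i → pow (h i) d ≈ id) ×
                   (∀ d' → 0 < d' → (∀ i → pow (h i) d' ≈ id) → d ≤ d')

  module _ {A : Obj} (F : IFStructure A) where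
    open IFStructure F

    _⊕_ : Hom A A → Hom A A → Hom A A
    f ⊕ f' = μr ∘ (f ⊗₁ f') ∘ δg

    internal : ℕ → Hom A A
    internal zero    = ηr ∘ εg
    internal (suc n) = μr ∘ (internal n ⊗₁ id) ∘ δg

{-# OPTIONS --safe #-}
-- A convolution f ⊕ g sends a green-copyable point ψ to μr ∘ (f ψ ⊗ g ψ), and
-- red phases slide out of μr; so for a red phase h with h ∘ ηr green-copyable,
-- induction shows that the internal integer n sends h ∘ ηr to hⁿ ∘ ηr. (The base
-- case uses that a copyable point is fixed by its counit scalar, and that h is
-- unitary.) As hᵈ = id for every h ∈ H_K, these points depend only on n mod d,
-- and enough green-set-like elements make n = m as maps.
module Submission where

open import Defs
open import Level using (Level)
open import Data.Nat using (ℕ; zero; suc; _+_; _*_; _∸_; _≤_)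
open import Data.Nat.Properties using (≤-total; m+[n∸m]≡n)
import Data.Nat.Divisibility as ℕ
open import Data.Integer using (+_; _-_; ∣_∣)
open import Data.Integer.Divisibility using (_∣_)
open import Data.Integer.Properties using ([+m]-[+n]≡m⊖n; ∣⊖∣-≤; ∣i-j∣≡∣j-i∣)
open import Data.Product using (_,_)
open import Data.Sum using (inj₁; inj₂)
open import Relation.Binary.PropositionalEquality as ≡ using (_≡_; refl)
open import Relation.Binary.Structures using (IsEquivalence)
open import Relation.Binary.Bundles using (Setoid)
import Relation.Binary.Reasoning.Setoid as SetoidReasoning

∣+m-+n∣≡n∸m : ∀ {m n} → m ≤ n → ∣ + m - + n ∣ ≡ n ∸ m
∣+m-+n∣≡n∸m {m} {n} m≤n = ≡.trans (≡.cong ∣_∣ ([+m]-[+n]≡m⊖n m n)) (∣⊖∣-≤ m≤n)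

∣+n-+m∣≡n∸m : ∀ {m n} → m ≤ n → ∣ + n - + m ∣ ≡ n ∸ m
∣+n-+m∣≡n∸m {m} {n} m≤n = ≡.trans (∣i-j∣≡∣j-i∣ (+ n) (+ m)) (∣+m-+n∣≡n∸m m≤n)

module Categorical {o ℓ e} (C : StrictSymMonDaggerCat o ℓ e) where
  open StrictSymMonDaggerCat C

  module ≈ {X Y} = IsEquivalence (≈-equiv {X} {Y})

  hom-setoid : Obj → Obj → Setoid ℓ e
  hom-setoid X Y = record { isEquivalence = ≈-equiv {X} {Y} }

  module HomReasoning {X Y} = SetoidReasoning (hom-setoid X Y)

  private
    variable
      X Y Z : Obj
      f f' g g' h : Hom X Y

  infixr 4 _⟩∘⟨_ refl⟩∘⟨_ _⟩⊗⟨_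
  infixl 5 _⟩∘⟨refl

  _⟩∘⟨_ : f ≈ f' → g ≈ g' → f ∘ g ≈ f' ∘ g'
  _⟩∘⟨_ = ∘-resp-≈

  refl⟩∘⟨_ : g ≈ g' → f ∘ g ≈ f ∘ g'
  refl⟩∘⟨ p = ≈.refl ⟩∘⟨ p

  _⟩∘⟨refl : f ≈ f' → f ∘ g ≈ f' ∘ g
  p ⟩∘⟨refl = p ⟩∘⟨ ≈.refl

  _⟩⊗⟨_ : f ≈ f' → g ≈ g' → f ⊗₁ g ≈ f' ⊗₁ g'
  _⟩⊗⟨_ = ⊗-resp-≈

  pullˡ : f ∘ g ≈ h → f ∘ g ∘ f' ≈ h ∘ f'
  pullˡ p = ≈.trans (≈.sym assoc) (p ⟩∘⟨refl)

  cancelˡ : f ∘ g ≈ id → f ∘ g ∘ f' ≈ f'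
  cancelˡ p = ≈.trans (pullˡ p) identityˡ

  pullʳ : f ∘ g ≈ h → (f' ∘ f) ∘ g ≈ f' ∘ h
  pullʳ p = ≈.trans assoc (refl⟩∘⟨ p)

  serialize₁₂ : f ⊗₁ g ≈ (f ⊗₁ id) ∘ (id ⊗₁ g)
  serialize₁₂ = ≈.trans (≈.sym identityʳ ⟩⊗⟨ ≈.sym identityˡ) ⊗-∘

  serialize₂₁ : f ⊗₁ g ≈ (id ⊗₁ g) ∘ (f ⊗₁ id)
  serialize₂₁ = ≈.trans (≈.sym identityˡ ⟩⊗⟨ ≈.sym identityʳ) ⊗-∘

  left-inverse⇒mono : g ∘ f ≈ id → f ∘ f' ≈ f ∘ g' → f' ≈ g'
  left-inverse⇒mono {g = g} {f = f} {f' = f'} {g' = g'} inv eq = begin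
    f'           ≈⟨ ≈.sym (cancelˡ inv) ⟩
    g ∘ f ∘ f'   ≈⟨ refl⟩∘⟨ eq ⟩
    g ∘ f ∘ g'   ≈⟨ cancelˡ inv ⟩
    g'           ∎
    where open HomReasoning

  cast-∘ : (p : X ≡ Y) (q : Y ≡ Z) → cast cat q ∘ cast cat p ≈ cast cat (≡.trans p q)
  cast-∘ refl q = identityʳ

  -- Matching the second proof against refl uses axiom K.
  cast-irrelevant : (p q : X ≡ Y) → cast cat p ≈ cast cat q
  cast-irrelevant refl refl = ≈.refl

  cast-cancel : (p : X ≡ Y) (q : Y ≡ X) → cast cat q ∘ cast cat p ≈ id
  cast-cancel p q = ≈.trans (cast-∘ p q) (cast-irrelevant _ refl)

  cast-† : (p : X ≡ Y) → cast cat p † ≈ cast cat (≡.sym p)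
  cast-† refl = †-id

  λ⇒ : Hom (I ⊗₀ X) X
  λ⇒ = cast cat unitˡObj

  λ⇐ : Hom X (I ⊗₀ X)
  λ⇐ = cast cat (≡.sym unitˡObj)

  λ⇒∘λ⇐ : λ⇒ ∘ λ⇐ ≈ id {X}
  λ⇒∘λ⇐ = cast-cancel _ _

  scalar-unitˡ : (s : Hom I I) → λ⇒ ∘ (s ⊗₁ id) ∘ λ⇐ ≈ s
  scalar-unitˡ s = begin
    λ⇒ ∘ (s ⊗₁ id) ∘ λ⇐                      ≈⟨ cast-irrelevant _ unitʳObj ⟩∘⟨refl ⟩
    cast cat unitʳObj ∘ (s ⊗₁ id) ∘ λ⇐       ≈⟨ pullˡ unitʳ-⊗₁ ⟩
    (s ∘ cast cat unitʳObj) ∘ λ⇐             ≈⟨ pullʳ (cast-cancel _ _) ⟩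
    s ∘ id                                   ≈⟨ identityʳ ⟩
    s                                        ∎
    where open HomReasoning

  pow-+ : (a : Hom X X) (m n : ℕ) → pow C a (m + n) ≈ pow C a m ∘ pow C a n
  pow-+ a zero    n = ≈.sym identityˡ
  pow-+ a (suc m) n = ≈.trans (refl⟩∘⟨ pow-+ a m n) (≈.sym assoc)

  module _ {a : Hom X X} {d : ℕ} (aᵈ≈id : pow C a d ≈ id) where

    pow-multiple : ∀ k → pow C a (k * d) ≈ id
    pow-multiple zero    = ≈.refl
    pow-multiple (suc k) =
      ≈.trans (pow-+ a d (k * d)) (≈.trans (aᵈ≈id ⟩∘⟨ pow-multiple k) identityˡ)

    pow-periodic : ∀ {m n} → m ≤ n → d ℕ.∣ n ∸ m → pow C a n ≈ pow C a m
    pow-periodic {m} {n} m≤n (ℕ.divides k n∸m≡kd) = begin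
      pow C a n                   ≡⟨ ≡.cong (pow C a) (≡.sym (m+[n∸m]≡n m≤n)) ⟩
      pow C a (m + (n ∸ m))       ≡⟨ ≡.cong (λ j → pow C a (m + j)) n∸m≡kd ⟩
      pow C a (m + k * d)         ≈⟨ pow-+ a m (k * d) ⟩
      pow C a m ∘ pow C a (k * d) ≈⟨ refl⟩∘⟨ pow-multiple k ⟩
      pow C a m ∘ id              ≈⟨ identityʳ ⟩
      pow C a m                   ∎
      where open HomReasoning

    pow-congruent : ∀ n m → + d ∣ + n - + m → pow C a n ≈ pow C a m
    pow-congruent n m d∣n-m with ≤-total m n
    ... | inj₁ m≤n = pow-periodic m≤n (≡.subst (d ℕ.∣_) (∣+n-+m∣≡n∸m m≤n) d∣n-m)
    ... | inj₂ n≤m = ≈.sym (pow-periodic n≤m (≡.subst (d ℕ.∣_) (∣+m-+n∣≡n∸m n≤m) d∣n-m))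

  module Frobenius {A : Obj} (S : DaggerSCFA C A) where
    open DaggerSCFA S

    Linear : Hom A A → Set e
    Linear f = μ ∘ (f ⊗₁ id) ≈ f ∘ μ

    ε-counitˡ : (ε ⊗₁ id) ∘ δ ≈ λ⇐
    ε-counitˡ = begin
      (η † ⊗₁ id) ∘ μ †     ≈⟨ (≈.refl ⟩⊗⟨ ≈.sym †-id) ⟩∘⟨refl ⟩
      (η † ⊗₁ id †) ∘ μ †   ≈⟨ ≈.sym †-⊗ ⟩∘⟨refl ⟩
      (η ⊗₁ id) † ∘ μ †     ≈⟨ ≈.sym †-∘ ⟩
      (μ ∘ (η ⊗₁ id)) †     ≈⟨ †-resp-≈ μ-unitˡ ⟩
      λ⇒ †                  ≈⟨ cast-† unitˡObj ⟩
      λ⇐                    ∎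
      where open HomReasoning

    copyable-fixed-by-ε : {ψ : Hom I A} → SetLike C S ψ → ψ ∘ ε ∘ ψ ≈ ψ
    copyable-fixed-by-ε {ψ} copy = begin
      ψ ∘ ε ∘ ψ                              ≈⟨ refl⟩∘⟨ ≈.sym (scalar-unitˡ (ε ∘ ψ)) ⟩
      ψ ∘ λ⇒ ∘ ((ε ∘ ψ) ⊗₁ id) ∘ λ⇐          ≈⟨ ≈.trans (pullˡ (≈.sym unitˡ-⊗₁)) assoc ⟩
      λ⇒ ∘ (id ⊗₁ ψ) ∘ ((ε ∘ ψ) ⊗₁ id) ∘ λ⇐  ≈⟨ refl⟩∘⟨ pullˡ (≈.sym serialize₂₁) ⟩
      λ⇒ ∘ ((ε ∘ ψ) ⊗₁ ψ) ∘ λ⇐               ≈⟨ refl⟩∘⟨ (≈.refl ⟩⊗⟨ ≈.sym identityˡ) ⟩∘⟨refl ⟩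
      λ⇒ ∘ ((ε ∘ ψ) ⊗₁ (id ∘ ψ)) ∘ λ⇐        ≈⟨ refl⟩∘⟨ ≈.trans (⊗-∘ ⟩∘⟨refl) assoc ⟩
      λ⇒ ∘ (ε ⊗₁ id) ∘ (ψ ⊗₁ ψ) ∘ λ⇐         ≈⟨ refl⟩∘⟨ refl⟩∘⟨ ≈.sym copy ⟩
      λ⇒ ∘ (ε ⊗₁ id) ∘ δ ∘ ψ                 ≈⟨ refl⟩∘⟨ pullˡ ε-counitˡ ⟩
      λ⇒ ∘ λ⇐ ∘ ψ                            ≈⟨ cancelˡ λ⇒∘λ⇐ ⟩
      ψ                                      ∎
      where open HomReasoning

    μ-η⊗η : μ ∘ (η ⊗₁ η) ∘ λ⇐ ≈ η
    μ-η⊗η = begin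
      μ ∘ (η ⊗₁ η) ∘ λ⇐                ≈⟨ refl⟩∘⟨ ≈.trans (serialize₁₂ ⟩∘⟨refl) assoc ⟩
      μ ∘ (η ⊗₁ id) ∘ (id ⊗₁ η) ∘ λ⇐   ≈⟨ pullˡ μ-unitˡ ⟩
      λ⇒ ∘ (id ⊗₁ η) ∘ λ⇐              ≈⟨ ≈.trans (pullˡ unitˡ-⊗₁) assoc ⟩
      η ∘ λ⇒ ∘ λ⇐                      ≈⟨ ≈.trans (refl⟩∘⟨ λ⇒∘λ⇐) identityʳ ⟩
      η                                ∎
      where open HomReasoning

    linear-ʳ : {f : Hom A A} → Linear f → μ ∘ (id ⊗₁ f) ≈ f ∘ μ
    linear-ʳ {f} lin = begin
      μ ∘ (id ⊗₁ f)      ≈⟨ ≈.trans (≈.sym μ-comm ⟩∘⟨refl) assoc ⟩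
      μ ∘ σ ∘ (id ⊗₁ f)  ≈⟨ refl⟩∘⟨ σ-natural ⟩
      μ ∘ (f ⊗₁ id) ∘ σ  ≈⟨ pullˡ lin ⟩
      (f ∘ μ) ∘ σ        ≈⟨ pullʳ μ-comm ⟩
      f ∘ μ              ∎
      where open HomReasoning

    μ-⊗-linear : {f g : Hom A A} → Linear f → Linear g → μ ∘ (f ⊗₁ g) ≈ g ∘ f ∘ μ
    μ-⊗-linear {f} {g} lin-f lin-g = begin
      μ ∘ (f ⊗₁ g)              ≈⟨ refl⟩∘⟨ serialize₂₁ ⟩
      μ ∘ (id ⊗₁ g) ∘ (f ⊗₁ id) ≈⟨ pullˡ (linear-ʳ lin-g) ⟩
      (g ∘ μ) ∘ (f ⊗₁ id)       ≈⟨ pullʳ lin-f ⟩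
      g ∘ f ∘ μ                 ∎
      where open HomReasoning

    pow-linear : {f : Hom A A} → Linear f → ∀ n → Linear (pow C f n)
    pow-linear lin zero    = ≈.trans (refl⟩∘⟨ ⊗-id) (≈.trans identityʳ (≈.sym identityˡ))
    pow-linear {f} lin (suc n) = begin
      μ ∘ ((f ∘ fⁿ) ⊗₁ id)        ≈⟨ refl⟩∘⟨ ≈.trans (≈.refl ⟩⊗⟨ ≈.sym identityˡ) ⊗-∘ ⟩
      μ ∘ (f ⊗₁ id) ∘ (fⁿ ⊗₁ id)  ≈⟨ pullˡ lin ⟩
      (f ∘ μ) ∘ (fⁿ ⊗₁ id)        ≈⟨ pullʳ (pow-linear lin n) ⟩
      f ∘ fⁿ ∘ μ                  ≈⟨ ≈.sym assoc ⟩
      (f ∘ fⁿ) ∘ μ                ∎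
      where
        open HomReasoning
        fⁿ : Hom A A
        fⁿ = pow C f n

  module InternalIntegers {A : Obj} (F : IFStructure C A) where
    open IFStructure F
    open Frobenius green using (copyable-fixed-by-ε)
    open Frobenius red using (μ-η⊗η; μ-⊗-linear; pow-linear)

    ⊕-on-copyable : {ψ : Hom I A} → SetLike C green ψ → (f g : Hom A A) →
                    _⊕_ C F f g ∘ ψ ≈ μr ∘ ((f ∘ ψ) ⊗₁ (g ∘ ψ)) ∘ λ⇐
    ⊕-on-copyable {ψ} copy f g = begin
      (μr ∘ (f ⊗₁ g) ∘ δg) ∘ ψ        ≈⟨ pullʳ assoc ⟩
      μr ∘ (f ⊗₁ g) ∘ δg ∘ ψ          ≈⟨ refl⟩∘⟨ refl⟩∘⟨ copy ⟩
      μr ∘ (f ⊗₁ g) ∘ (ψ ⊗₁ ψ) ∘ λ⇐   ≈⟨ refl⟩∘⟨ pullˡ (≈.sym ⊗-∘) ⟩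
      μr ∘ ((f ∘ ψ) ⊗₁ (g ∘ ψ)) ∘ λ⇐  ∎
      where open HomReasoning

    internal-on-phase-point : {a : Hom A A} → IsPhase C red a → SetLike C green (a ∘ ηr) →
                              ∀ n → internal C F n ∘ a ∘ ηr ≈ pow C a n ∘ ηr
    internal-on-phase-point {a} ((a†a≈id , _) , _) copy zero = begin
      (ηr ∘ εg) ∘ a ∘ ηr  ≈⟨ ≈.trans assoc ηr-fixed ⟩
      ηr                  ≈⟨ ≈.sym identityˡ ⟩
      id ∘ ηr             ∎
      where
        open HomReasoning
        ηr-fixed : ηr ∘ εg ∘ a ∘ ηr ≈ ηr
        ηr-fixed = left-inverse⇒mono a†a≈id (≈.trans (≈.sym assoc) (copyable-fixed-by-ε copy))
    internal-on-phase-point {a} phase@(_ , lin) copy (suc n) = begin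
      _⊕_ C F (internal C F n) id ∘ a ∘ ηr
        ≈⟨ ⊕-on-copyable copy (internal C F n) id ⟩
      μr ∘ ((internal C F n ∘ a ∘ ηr) ⊗₁ (id ∘ a ∘ ηr)) ∘ λ⇐
        ≈⟨ refl⟩∘⟨ (internal-on-phase-point phase copy n ⟩⊗⟨ identityˡ) ⟩∘⟨refl ⟩
      μr ∘ ((aⁿ ∘ ηr) ⊗₁ (a ∘ ηr)) ∘ λ⇐
        ≈⟨ refl⟩∘⟨ ≈.trans (⊗-∘ ⟩∘⟨refl) assoc ⟩
      μr ∘ (aⁿ ⊗₁ a) ∘ (ηr ⊗₁ ηr) ∘ λ⇐
        ≈⟨ pullˡ (μ-⊗-linear (pow-linear lin n) lin) ⟩
      (a ∘ aⁿ ∘ μr) ∘ (ηr ⊗₁ ηr) ∘ λ⇐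
        ≈⟨ pullʳ (pullʳ μ-η⊗η) ⟩
      a ∘ aⁿ ∘ ηr
        ≈⟨ ≈.sym assoc ⟩
      (a ∘ aⁿ) ∘ ηr
        ∎
      where
        open HomReasoning
        aⁿ : Hom A A
        aⁿ = pow C a n

theorem11 : ∀ {o ℓ e ℓG : Level} (C : StrictSymMonDaggerCat o ℓ e)
    {A : StrictSymMonDaggerCat.Obj C} (F : IFStructure C A) (K : IFK C F ℓG) →
    EnoughGreenSetLike C K → (d : ℕ) → IsExponent C K d →
    ∀ (n m : ℕ) → (+ d) ∣ (+ n - + m) →
    StrictSymMonDaggerCat._≈_ C (internal C F n) (internal C F m)
theorem11 C F K enough d (_ , hᵈ≈id , _) n m d∣n-m =
  enough (internal C F n) (internal C F m) λ i → begin
    internal C F n ∘ h i ∘ ηr  ≈⟨ internal-on-phase-point (H-phase i) (H-eq i) n ⟩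
    pow C (h i) n ∘ ηr         ≈⟨ pow-congruent (hᵈ≈id i) n m d∣n-m ⟩∘⟨refl ⟩
    pow C (h i) m ∘ ηr         ≈⟨ ≈.sym (internal-on-phase-point (H-phase i) (H-eq i) m) ⟩
    internal C F m ∘ h i ∘ ηr  ∎
  where
    open StrictSymMonDaggerCat C using (_∘_)
    open Categorical C
    open HomReasoning
    open InternalIntegers F
    open IFStructure F using (ηr)
    open IFK K using (h; H-phase; H-eq)
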